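{- Let $G$ be a graph on $n$ vertices and $t \ge 1$. For each $T \in \mathcal{K}_t(G)$ let $\theta_G(T) = \max\{d_G(v) : v \in T\}$. Then \[ \sum_{T \in \mathcal{K}_t(G)} \frac{1}{\binom{\theta_G(T)}{t-1}} \le \frac{n}{t}. \] When $t = 2$, equality holds if and only if $G$ contains no isolated vertices and each component of $G$ is regular. When $t \ge 3$, equality holds if and only if $G$ is a disjoint union of complete graphs of order at least $t$.
   Context: $\mathcal{K}_t(G) = \{S \subseteq V(G) : G[S] \cong K_t\}$ is the set of vertex sets of $t$-cliques of $G$; $d_G(v)$ is the degree of $v$ in $G$. -}

module Defs where

open import Data.Bool using (Bool; T?; true; false; _∧_; if_then_else_; not)
open import Data.Nat using (ℕ; zero; suc; _⊔_; _≡ᵇ_; _≤_; _∸_)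
open import Data.Nat.Combinatorics using (_C_)
open import Data.Fin using (Fin; _≟_)
open import Data.Fin.Subset using (Subset; _∈_; ∣_∣; outside; inside)
open import Data.Vec using (Vec; []; _∷_; lookup)
open import Data.List using (List; []; _∷_; map; filter; foldr; _++_; allFin)
open import Data.Integer using (+_)
open import Data.Rational using (ℚ; 0ℚ; 1ℚ; _/_; _+_)
open import Relation.Binary.PropositionalEquality using (_≡_; _≢_)
open import Relation.Nullary using (¬_)
open import Relation.Nullary.Decidable using (⌊_⌋)
open import Data.Product using (_×_; ∃)

record Graph (n : ℕ) : Set where
  field
    adj   : Fin n → Fin n → Bool
    sym   : ∀ u v → adj u v ≡ adj v u
    loopless : ∀ v → adj v v ≡ false
open Graph public

countV : ∀ {n} → (Fin n → Bool) → ℕ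
countV {n} p = foldr (λ v acc → if p v then suc acc else acc) 0 (allFin n)

degree : ∀ {n} → Graph n → Fin n → ℕ
degree G v = countV (adj G v)

allSubsets : (n : ℕ) → List (Subset n)
allSubsets zero = [] ∷ []
allSubsets (suc n) = map (outside ∷_) (allSubsets n) ++ map (inside ∷_) (allSubsets n)

memb : ∀ {n} → Subset n → Fin n → Bool
memb S v = lookup S v

allAdjB : ∀ {n} → Graph n → Subset n → Bool
allAdjB {n} G S =
  foldr _∧_ true (map (λ u → foldr _∧_ true (map (λ v →
     if memb S u ∧ memb S v ∧ not ⌊ u ≟ v ⌋ then adj G u v else true) (allFin n))) (allFin n))

cliques : ∀ {n} → Graph n → ℕ → List (Subset n)
cliques {n} G t = filter (λ S → T? (allAdjB G S ∧ (∣ S ∣ ≡ᵇ t))) (allSubsets n)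

theta : ∀ {n} → Graph n → Subset n → ℕ
theta {n} G T = foldr (λ v acc → if memb T v then degree G v ⊔ acc else acc) 0 (allFin n)

-- 1/m as a rational (m = 0 never occurs below since θ ≥ t-1 for a t-clique)
recip : ℕ → ℚ
recip zero = 0ℚ
recip (suc m) = + 1 / suc m

sumℚ : List ℚ → ℚ
sumℚ = foldr _+_ 0ℚ

cliqueSum : ∀ {n} → Graph n → ℕ → ℚ
cliqueSum G t = sumℚ (map (λ T → recip (theta G T C (t ∸ 1))) (cliques G t))

data Connected {n} (G : Graph n) : Fin n → Fin n → Set where
  here : ∀ {v} → Connected G v v
  step : ∀ {u v w} → adj G u v ≡ true → Connected G v w → Connected G u w

NoIsolated : ∀ {n} → Graph n → Set
NoIsolated G = ∀ v → ¬ (degree G v ≡ 0)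

ComponentsRegular : ∀ {n} → Graph n → Set
ComponentsRegular G = ∀ u v → Connected G u v → degree G u ≡ degree G v

DisjointUnionOfCliques : ∀ {n} → Graph n → ℕ → Set
DisjointUnionOfCliques {n} G t =
  (∀ u v → Connected G u v → u ≢ v → adj G u v ≡ true)
  × (∀ v → ∃ λ (C : Subset n) → v ∈ C × (∀ w → w ∈ C → Connected G v w) × t ≤ ∣ C ∣)

{-# OPTIONS --safe #-}
module Submission where

-- Write t = k + 1 and w(d) = 1 / C(d, k). If v lies in a t-clique T then k ≤ d(v) ≤ θ(T), so
-- w(θ(T)) ≤ w(d(v)), and summing over the t vertices of T gives t·w(θ(T)) ≤ Σ_{v∈T} w(d(v)).
-- Summing over all t-cliques and exchanging the sums, t·Σ_T w(θ(T)) ≤ Σ_v N(v)·w(d(v)), where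
-- N(v) counts the t-cliques through v. Deleting v maps these injectively to k-subsets of the
-- neighbourhood of v, so N(v) ≤ C(d(v), k) and every vertex contributes at most 1.
-- Equality therefore holds iff every vertex is saturated (each k-subset of its neighbourhood
-- spans a clique with it, and C(d(v), k) ≥ 1) and every clique is balanced (w(θ(T)) = w(d(v))
-- for v ∈ T). For t = 2 this says that no vertex is isolated and adjacent vertices have equal
-- degree. For t ≥ 3 saturation makes every neighbourhood a clique of size at least k, i.e. every
-- component is complete of order at least t, and then balance is automatic.

module CliqueSumBound where

  open import Level using (0ℓ)
  open import Algebra.Bundles using (CommutativeMonoid)
  open import Algebra.Core using (Op₂)
  open import Algebra.Structures using (IsCommutativeMonoid)
  open import Data.Bool using (Bool; true; false; if_then_else_; _∧_; _∨_; not; T?)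
  open import Data.Bool.Properties using (∧-conicalˡ; ∧-conicalʳ; ∧-zeroʳ; ∨-zeroʳ; not-injective)
  open import Data.Empty using (⊥-elim)
  open import Data.Fin using (Fin; zero; suc; _≟_)
  import Data.Fin.Properties as FinP
  open import Data.Fin.Subset as Subset using (Subset; ∣_∣)
  open import Data.Integer as ℤ using (ℤ; +_)
  import Data.Integer.Properties as ℤP
  open import Data.Integer.Tactic.RingSolver using (solve-∀)
  open import Data.List using (List; []; _∷_; _++_; map; foldr; length; tabulate; filter; allFin)
  import Data.List.Properties as ListP
  open import Data.List.Membership.Propositional using (_∈_)
  open import Data.List.Membership.Propositional.Properties using (∈-++⁺ˡ; ∈-++⁺ʳ; ∈-map⁺; ∈-allFin)
  open import Data.List.Relation.Unary.Any using (here; there)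
  open import Data.Nat as ℕ using (ℕ; zero; suc; _+_; _≤_; _<_; _⊔_; _≡ᵇ_; z≤n; s≤s; NonZero)
  import Data.Nat.Properties as ℕP
  open import Data.Nat.Combinatorics using (_C_; nC1≡n; nCk+nC[k+1]≡[n+1]C[k+1])
  open import Data.Nat.Combinatorics.Specification using (k>n⇒nCk≡0)
  open import Data.Product using (_×_; _,_; ∃; proj₂)
  open import Data.Rational as ℚ using (ℚ; mkℚ; 0ℚ; 1ℚ; toℚᵘ)
  import Data.Rational.Properties as ℚP
  open import Data.Rational.Unnormalised as ℚᵘ using (mkℚᵘ; *≡*; *≤*)
  import Data.Rational.Unnormalised.Properties as ℚᵘP
  open import Data.Sum using (_⊎_; inj₁; inj₂)
  open import Data.Vec as Vec using ([]; _∷_)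
  import Data.Vec.Properties as VecP
  open import Function using (_∘_)
  open import Function.Bundles using (_⇔_; mk⇔; Equivalence)
  open import Relation.Binary.Core using (Rel)
  open import Relation.Binary.Definitions using (Irreflexive; Monotonic₂)
  open import Relation.Binary.PropositionalEquality
  open import Relation.Binary.Structures using (IsPartialOrder)
  open import Relation.Nullary using (¬_; yes; no; does)
  open import Relation.Nullary.Decidable using (⌊_⌋; dec-true; dec-false; isYes≗does)
  open import Defs hiding (sym)

  indicator : Bool → ℕ
  indicator b = if b then 1 else 0

  count : ∀ {A : Set} → (A → Bool) → List A → ℕ
  count p = foldr (λ x acc → indicator (p x) + acc) 0

  toggle : ∀ {n} → Fin n → Subset n → Subset n
  toggle zero    (b ∷ S) = not b ∷ S
  toggle (suc v) (b ∷ S) = b ∷ toggle v S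

  module ListSum {M : Set} {_∙_ : Op₂ M} {ε : M} (isCM : IsCommutativeMonoid _≡_ _∙_ ε) where

    commutativeMonoid : CommutativeMonoid 0ℓ 0ℓ
    commutativeMonoid = record { isCommutativeMonoid = isCM }

    open CommutativeMonoid commutativeMonoid using (assoc; comm; identityˡ; commutativeSemigroup)
    open import Algebra.Properties.CommutativeSemigroup commutativeSemigroup using (interchange)
    open import Algebra.Properties.CommutativeMonoid.Mult commutativeMonoid public
      using () renaming (_×_ to _·_; ×-distrib-+ to ·-distrib-∙)
    open ≡-Reasoning

    ∑ : ∀ {A : Set} → List A → (A → M) → M
    ∑ xs f = foldr (λ x acc → f x ∙ acc) ε xs

    ∑-cong : ∀ {A : Set} (xs : List A) {f g : A → M} → (∀ x → f x ≡ g x) → ∑ xs f ≡ ∑ xs g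
    ∑-cong []       f≗g = refl
    ∑-cong (x ∷ xs) f≗g = cong₂ _∙_ (f≗g x) (∑-cong xs f≗g)

    ∑-++ : ∀ {A : Set} (xs ys : List A) (f : A → M) → ∑ (xs ++ ys) f ≡ ∑ xs f ∙ ∑ ys f
    ∑-++ []       ys f = sym (identityˡ _)
    ∑-++ (x ∷ xs) ys f = trans (cong (f x ∙_) (∑-++ xs ys f)) (sym (assoc _ _ _))

    ∑-map : ∀ {A B : Set} (g : A → B) (xs : List A) (f : B → M) → ∑ (map g xs) f ≡ ∑ xs (λ x → f (g x))
    ∑-map g []       f = refl
    ∑-map g (x ∷ xs) f = cong (f (g x) ∙_) (∑-map g xs f)

    ∑-ε : ∀ {A : Set} (xs : List A) → ∑ xs (λ _ → ε) ≡ ε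
    ∑-ε []       = refl
    ∑-ε (x ∷ xs) = trans (identityˡ _) (∑-ε xs)

    ∑-∙ : ∀ {A : Set} (xs : List A) (f g : A → M) → ∑ xs (λ x → f x ∙ g x) ≡ ∑ xs f ∙ ∑ xs g
    ∑-∙ []       f g = sym (identityˡ ε)
    ∑-∙ (x ∷ xs) f g = trans (cong ((f x ∙ g x) ∙_) (∑-∙ xs f g)) (interchange _ _ _ _)

    ∑-comm : ∀ {A B : Set} (xs : List A) (ys : List B) (f : A → B → M) →
             ∑ xs (λ x → ∑ ys (f x)) ≡ ∑ ys (λ y → ∑ xs (λ x → f x y))
    ∑-comm []       ys f = sym (∑-ε ys)
    ∑-comm (x ∷ xs) ys f = begin
      ∑ ys (f x) ∙ ∑ xs (λ x′ → ∑ ys (f x′))          ≡⟨ cong (∑ ys (f x) ∙_) (∑-comm xs ys f) ⟩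
      ∑ ys (f x) ∙ ∑ ys (λ y → ∑ xs (λ x′ → f x′ y))  ≡⟨ ∑-∙ ys (f x) _ ⟨
      ∑ ys (λ y → f x y ∙ ∑ xs (λ x′ → f x′ y))       ∎

    ·-ε : ∀ m → m · ε ≡ ε
    ·-ε zero    = refl
    ·-ε (suc m) = trans (identityˡ _) (·-ε m)

    ·-distrib-∑ : ∀ {A : Set} m (xs : List A) (f : A → M) → m · ∑ xs f ≡ ∑ xs (λ x → m · f x)
    ·-distrib-∑ m []       f = ·-ε m
    ·-distrib-∑ m (x ∷ xs) f =
      trans (·-distrib-∙ (f x) (∑ xs f) m) (cong ((m · f x) ∙_) (·-distrib-∑ m xs f))

    ∑-indicator : ∀ {A : Set} (xs : List A) (p : A → Bool) (c : M) →
                  ∑ xs (λ x → if p x then c else ε) ≡ count p xs · c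
    ∑-indicator []       p c = refl
    ∑-indicator (x ∷ xs) p c with p x
    ... | true  = cong (c ∙_) (∑-indicator xs p c)
    ... | false = trans (identityˡ _) (∑-indicator xs p c)

    ∑-const : ∀ {A : Set} (xs : List A) (c : M) → ∑ xs (λ _ → c) ≡ length xs · c
    ∑-const []       c = refl
    ∑-const (x ∷ xs) c = cong (c ∙_) (∑-const xs c)

    ∑-allSubsets-suc : ∀ n (f : Subset (suc n) → M) →
      ∑ (allSubsets (suc n)) f ≡ ∑ (allSubsets n) (λ S → f (false ∷ S)) ∙ ∑ (allSubsets n) (λ S → f (true ∷ S))
    ∑-allSubsets-suc n f = trans (∑-++ (map (false ∷_) (allSubsets n)) _ f)
      (cong₂ _∙_ (∑-map (false ∷_) (allSubsets n) f) (∑-map (true ∷_) (allSubsets n) f))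

    ∑-allSubsets-toggle : ∀ n (v : Fin n) (f : Subset n → M) →
                          ∑ (allSubsets n) (λ S → f (toggle v S)) ≡ ∑ (allSubsets n) f
    ∑-allSubsets-toggle (suc n) zero f = begin
      ∑ (allSubsets (suc n)) (λ S → f (toggle zero S))                               ≡⟨ ∑-allSubsets-suc n _ ⟩
      ∑ (allSubsets n) (λ S → f (true ∷ S)) ∙ ∑ (allSubsets n) (λ S → f (false ∷ S)) ≡⟨ comm _ _ ⟩
      ∑ (allSubsets n) (λ S → f (false ∷ S)) ∙ ∑ (allSubsets n) (λ S → f (true ∷ S)) ≡⟨ ∑-allSubsets-suc n f ⟨
      ∑ (allSubsets (suc n)) f                                                       ∎
    ∑-allSubsets-toggle (suc n) (suc v) f = begin
      ∑ (allSubsets (suc n)) (λ S → f (toggle (suc v) S))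
        ≡⟨ ∑-allSubsets-suc n _ ⟩
      ∑ (allSubsets n) (λ S → f (false ∷ toggle v S)) ∙ ∑ (allSubsets n) (λ S → f (true ∷ toggle v S))
        ≡⟨ cong₂ _∙_ (∑-allSubsets-toggle n v (λ S → f (false ∷ S))) (∑-allSubsets-toggle n v (λ S → f (true ∷ S))) ⟩
      ∑ (allSubsets n) (λ S → f (false ∷ S)) ∙ ∑ (allSubsets n) (λ S → f (true ∷ S))
        ≡⟨ ∑-allSubsets-suc n f ⟨
      ∑ (allSubsets (suc n)) f
        ∎

  module ListSumMonotone {M : Set} {_∙_ : Op₂ M} {ε : M} (isCM : IsCommutativeMonoid _≡_ _∙_ ε)
    {_≤_ _<_ : Rel M 0ℓ} (≤-isPartialOrder : IsPartialOrder _≡_ _≤_)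
    (∙-mono-≤ : Monotonic₂ _≤_ _≤_ _≤_ _∙_)
    (∙-mono-<-≤ : Monotonic₂ _<_ _≤_ _<_ _∙_) (∙-mono-≤-< : Monotonic₂ _≤_ _<_ _<_ _∙_)
    (≮⇒≥ : ∀ {a b} → ¬ a < b → b ≤ a) (<-irrefl : Irreflexive _≡_ _<_) where

    open ListSum isCM using (∑)
    open IsPartialOrder ≤-isPartialOrder using (antisym) renaming (refl to ≤-refl)

    ∑-mono-≤ : ∀ {A : Set} (xs : List A) {f g : A → M} → (∀ x → x ∈ xs → f x ≤ g x) → ∑ xs f ≤ ∑ xs g
    ∑-mono-≤ []       f≤g = ≤-refl
    ∑-mono-≤ (x ∷ xs) f≤g = ∙-mono-≤ (f≤g x (here refl)) (∑-mono-≤ xs (λ y y∈ → f≤g y (there y∈)))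

    ∙-≤-≡⇒≡ : ∀ {a b c d} → a ≤ b → c ≤ d → a ∙ c ≡ b ∙ d → a ≡ b × c ≡ d
    ∙-≤-≡⇒≡ a≤b c≤d eq =
      antisym a≤b (≮⇒≥ (λ a<b → <-irrefl eq (∙-mono-<-≤ a<b c≤d))) ,
      antisym c≤d (≮⇒≥ (λ c<d → <-irrefl eq (∙-mono-≤-< a≤b c<d)))

    ∑-≤-≡⇒≡ : ∀ {A : Set} (xs : List A) {f g : A → M} → (∀ x → x ∈ xs → f x ≤ g x) →
              ∑ xs f ≡ ∑ xs g → ∀ x → x ∈ xs → f x ≡ g x
    ∑-≤-≡⇒≡ (y ∷ xs) f≤g eq x x∈
      with ∙-≤-≡⇒≡ (f≤g y (here refl)) (∑-mono-≤ xs (λ z z∈ → f≤g z (there z∈))) eq | x∈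
    ... | fy≡gy , _     | here refl = fy≡gy
    ... | _     , rest≡ | there x∈′ = ∑-≤-≡⇒≡ xs (λ z z∈ → f≤g z (there z∈)) rest≡ x x∈′

  module NatSum where
    open ListSum ℕP.+-0-isCommutativeMonoid public
    open ListSumMonotone ℕP.+-0-isCommutativeMonoid ℕP.≤-isPartialOrder
      ℕP.+-mono-≤ ℕP.+-mono-<-≤ ℕP.+-mono-≤-< ℕP.≮⇒≥ ℕP.<-irrefl public

  module RatSum where
    open ListSum ℚP.+-0-isCommutativeMonoid public
    open ListSumMonotone ℚP.+-0-isCommutativeMonoid ℚP.≤-isPartialOrder
      ℚP.+-mono-≤ ℚP.+-mono-<-≤ ℚP.+-mono-≤-< ℚP.≮⇒≥ ℚP.<-irrefl public

  open RatSum using (_·_)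

  private
    1+n≡suc : ∀ n → (ℚᵘ.1ℚᵘ ℚᵘ.+ mkℚᵘ (+ n) 0) ℚᵘ.≃ mkℚᵘ (+ suc n) 0
    1+n≡suc n = *≡* (trans (identity (+ n)) (cong (ℤ._* ℤ.1ℤ) (sym (ℤP.pos-+ 1 n))))
      where
      identity : ∀ (z : ℤ) → (ℤ.1ℤ ℤ.* ℤ.1ℤ ℤ.+ z ℤ.* ℤ.1ℤ) ℤ.* ℤ.1ℤ ≡ (ℤ.1ℤ ℤ.+ z) ℤ.* ℤ.1ℤ
      identity = solve-∀

    toℚᵘ-· : ∀ m x → toℚᵘ (m · x) ℚᵘ.≃ mkℚᵘ (+ m) 0 ℚᵘ.* toℚᵘ x
    toℚᵘ-· zero    x = ℚᵘP.≃-sym (ℚᵘP.*-zeroˡ (toℚᵘ x))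
    toℚᵘ-· (suc m) x = begin
      toℚᵘ (x ℚ.+ m · x)                                        ≈⟨ ℚP.toℚᵘ-homo-+ x (m · x) ⟩
      toℚᵘ x ℚᵘ.+ toℚᵘ (m · x)                                  ≈⟨ ℚᵘP.+-congʳ (toℚᵘ x) (toℚᵘ-· m x) ⟩
      toℚᵘ x ℚᵘ.+ mkℚᵘ (+ m) 0 ℚᵘ.* toℚᵘ x                      ≈⟨ ℚᵘP.+-congˡ _ (ℚᵘP.*-identityˡ (toℚᵘ x)) ⟨
      ℚᵘ.1ℚᵘ ℚᵘ.* toℚᵘ x ℚᵘ.+ mkℚᵘ (+ m) 0 ℚᵘ.* toℚᵘ x          ≈⟨ ℚᵘP.*-distribʳ-+ (toℚᵘ x) ℚᵘ.1ℚᵘ (mkℚᵘ (+ m) 0) ⟨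
      (ℚᵘ.1ℚᵘ ℚᵘ.+ mkℚᵘ (+ m) 0) ℚᵘ.* toℚᵘ x                    ≈⟨ ℚᵘP.*-congʳ {toℚᵘ x} (1+n≡suc m) ⟩
      mkℚᵘ (+ suc m) 0 ℚᵘ.* toℚᵘ x                              ∎
      where open ℚᵘP.≃-Reasoning

    toℚᵘ-recip : ∀ m → toℚᵘ (recip (suc m)) ℚᵘ.≃ mkℚᵘ (+ 1) m
    toℚᵘ-recip m = ℚP.toℚᵘ-fromℚᵘ (mkℚᵘ (+ 1) m)

    toℚᵘ-·-recip : ∀ m c → toℚᵘ (m · recip (suc c)) ℚᵘ.≃ mkℚᵘ (+ m) c
    toℚᵘ-·-recip m c = ℚᵘP.≃-trans (toℚᵘ-· m (recip (suc c)))
      (ℚᵘP.≃-trans (ℚᵘP.*-congˡ {mkℚᵘ (+ m) 0} (toℚᵘ-recip c)) (*≡* eq))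
      where
      eq : (+ m ℤ.* + 1) ℤ.* + suc c ≡ + m ℤ.* + suc (c ℕ.+ 0)
      eq rewrite ℕP.+-identityʳ c | ℤP.*-identityʳ (+ m) = refl

    toℚᵘ-·-1 : ∀ m → toℚᵘ (m · 1ℚ) ℚᵘ.≃ mkℚᵘ (+ m) 0
    toℚᵘ-·-1 m = ℚᵘP.≃-trans (toℚᵘ-· m 1ℚ) (ℚᵘP.*-identityʳ (mkℚᵘ (+ m) 0))

    toℚᵘ-/ : ∀ n k → toℚᵘ (+ n ℚ./ suc k) ℚᵘ.≃ mkℚᵘ (+ n) k
    toℚᵘ-/ n k = ℚP.toℚᵘ-fromℚᵘ (mkℚᵘ (+ n) k)

  ·-recip-≤-1 : ∀ m c → m ℕ.≤ c → m · recip c ℚ.≤ 1ℚ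
  ·-recip-≤-1 .zero zero    z≤n = ℚ.*≤* (ℤ.+≤+ z≤n)
  ·-recip-≤-1 m     (suc c) m≤c =
    ℚP.toℚᵘ-cancel-≤ (ℚᵘP.≤-respˡ-≃ (ℚᵘP.≃-sym (toℚᵘ-·-recip m c)) (*≤* le))
    where
    le : + m ℤ.* + 1 ℤ.≤ + 1 ℤ.* + suc c
    le rewrite ℤP.*-identityʳ (+ m) | ℤP.*-identityˡ (+ suc c) = ℤ.+≤+ m≤c

  ·-recip≡1⇒≡ : ∀ m c → m · recip c ≡ 1ℚ → m ≡ c × 1 ℕ.≤ c
  ·-recip≡1⇒≡ m zero    eq with trans (sym (RatSum.·-ε m)) eq
  ... | ()
  ·-recip≡1⇒≡ m (suc c) eq with ℚᵘP.≃-trans (ℚᵘP.≃-sym (toℚᵘ-·-recip m c)) (ℚP.toℚᵘ-cong eq)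
  ... | *≡* e =
    ℤP.+-injective (trans (sym (ℤP.*-identityʳ (+ m))) (trans e (ℤP.*-identityˡ (+ suc c)))) , s≤s z≤n

  ·-recip-self : ∀ c .{{_ : NonZero c}} → c · recip c ≡ 1ℚ
  ·-recip-self (suc c) = ℚP.toℚᵘ-injective (ℚᵘP.≃-trans (toℚᵘ-·-recip (suc c) c) (*≡* e))
    where
    e : + suc c ℤ.* + 1 ≡ + 1 ℤ.* + suc c
    e = trans (ℤP.*-identityʳ (+ suc c)) (sym (ℤP.*-identityˡ (+ suc c)))

  recip-antimono : ∀ a b → 1 ℕ.≤ a → a ℕ.≤ b → recip b ℚ.≤ recip a
  recip-antimono (suc a) (suc b) _ a≤b = ℚP.toℚᵘ-cancel-≤
    (ℚᵘP.≤-respˡ-≃ (ℚᵘP.≃-sym (toℚᵘ-recip b)) (ℚᵘP.≤-respʳ-≃ (ℚᵘP.≃-sym (toℚᵘ-recip a)) (*≤* le)))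
    where
    le : + 1 ℤ.* + suc a ℤ.≤ + 1 ℤ.* + suc b
    le rewrite ℤP.*-identityˡ (+ suc a) | ℤP.*-identityˡ (+ suc b) = ℤ.+≤+ a≤b

  recip-injective : ∀ a b .{{_ : NonZero a}} .{{_ : NonZero b}} → recip a ≡ recip b → a ≡ b
  recip-injective (suc a) (suc b) eq
    with ℚᵘP.≃-trans (ℚᵘP.≃-sym (toℚᵘ-recip a)) (ℚᵘP.≃-trans (ℚP.toℚᵘ-cong eq) (toℚᵘ-recip b))
  ... | *≡* e =
    sym (ℤP.+-injective (trans (sym (ℤP.*-identityˡ (+ suc b))) (trans e (ℤP.*-identityˡ (+ suc a)))))

  private
    swap-denominator : ∀ (s a : ℤ) → (s ℤ.* a) ℤ.* ℤ.1ℤ ≡ a ℤ.* s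
    swap-denominator = solve-∀

    drop-+0 : ∀ n b → + n ℤ.* + suc (b ℕ.+ 0) ≡ + n ℤ.* + suc b
    drop-+0 n b rewrite ℕP.+-identityʳ b = refl

  ·-≤-·1⇒≤-/ : ∀ t .{{_ : NonZero t}} n x → t · x ℚ.≤ n · 1ℚ → x ℚ.≤ + n ℚ./ t
  ·-≤-·1⇒≤-/ (suc k) n x@(mkℚ a b _) le
    with ℚᵘP.≤-respˡ-≃ (toℚᵘ-· (suc k) x) (ℚᵘP.≤-respʳ-≃ (toℚᵘ-·-1 n) (ℚP.toℚᵘ-mono-≤ le))
  ... | *≤* le′ = ℚP.toℚᵘ-cancel-≤ (ℚᵘP.≤-respʳ-≃ (ℚᵘP.≃-sym (toℚᵘ-/ n k))
         (*≤* (subst₂ ℤ._≤_ (swap-denominator (+ suc k) a) (drop-+0 n b) le′)))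

  ·≡·1⇔≡/ : ∀ t .{{_ : NonZero t}} n x → (t · x ≡ n · 1ℚ) ⇔ (x ≡ + n ℚ./ t)
  ·≡·1⇔≡/ (suc k) n x@(mkℚ a b _) = mk⇔ to from
    where
    to : suc k · x ≡ n · 1ℚ → x ≡ + n ℚ./ suc k
    to eq with ℚᵘP.≃-trans (ℚᵘP.≃-sym (toℚᵘ-· (suc k) x)) (ℚᵘP.≃-trans (ℚP.toℚᵘ-cong eq) (toℚᵘ-·-1 n))
    ... | *≡* e = ℚP.toℚᵘ-injective (ℚᵘP.≃-trans (*≡* (subst₂ _≡_ (swap-denominator (+ suc k) a) (drop-+0 n b) e))
                                                  (ℚᵘP.≃-sym (toℚᵘ-/ n k)))
    from : x ≡ + n ℚ./ suc k → suc k · x ≡ n · 1ℚ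
    from eq with ℚᵘP.≃-trans (ℚP.toℚᵘ-cong eq) (toℚᵘ-/ n k)
    ... | *≡* e = ℚP.toℚᵘ-injective (ℚᵘP.≃-trans (ℚᵘP.≃-trans (toℚᵘ-· (suc k) x)
                    (*≡* (subst₂ _≡_ (sym (swap-denominator (+ suc k) a)) (sym (drop-+0 n b)) e)))
                    (ℚᵘP.≃-sym (toℚᵘ-·-1 n)))

  ∧-intro : ∀ {a b} → a ≡ true → b ≡ true → a ∧ b ≡ true
  ∧-intro refl refl = refl

  ≡ᵇ⇒≡ : ∀ m n → (m ≡ᵇ n) ≡ true → m ≡ n
  ≡ᵇ⇒≡ zero    zero    e = refl
  ≡ᵇ⇒≡ (suc m) (suc n) e = cong suc (≡ᵇ⇒≡ m n e)

  ≡ᵇ-refl : ∀ m → (m ≡ᵇ m) ≡ true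
  ≡ᵇ-refl zero    = refl
  ≡ᵇ-refl (suc m) = ≡ᵇ-refl m

  ≡ᵇ-intro : ∀ {m n} → m ≡ n → (m ≡ᵇ n) ≡ true
  ≡ᵇ-intro {m} refl = ≡ᵇ-refl m

  indicator-mono : ∀ a b → (a ≡ true → b ≡ true) → indicator a ≤ indicator b
  indicator-mono false b a⇒b = z≤n
  indicator-mono true  b a⇒b rewrite a⇒b refl = s≤s z≤n

  indicator-injective : ∀ a b → indicator a ≡ indicator b → a ≡ b
  indicator-injective false false e = refl
  indicator-injective true  true  e = refl

  private
    foldr-tabulate : ∀ {A B : Set} n (c : A → B → B) (e : B) (f : Fin n → A) →
                     foldr c e (tabulate f) ≡ foldr (λ i → c (f i)) e (allFin n)
    foldr-tabulate zero    c e f = refl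
    foldr-tabulate (suc n) c e f =
      cong (c (f zero)) (trans (foldr-tabulate n c e (f ∘ suc)) (sym (foldr-tabulate n (c ∘ f) e suc)))

  countV-suc : ∀ {n} (p : Fin (suc n) → Bool) → countV p ≡ indicator (p zero) + countV (p ∘ suc)
  countV-suc {n} p with p zero
  ... | true  = cong suc (foldr-tabulate n _ 0 suc)
  ... | false = foldr-tabulate n _ 0 suc

  countV≡count : ∀ {n} (p : Fin n → Bool) → countV p ≡ count p (allFin n)
  countV≡count {n} p = go (allFin n)
    where
    go : ∀ xs → foldr (λ v acc → if p v then suc acc else acc) 0 xs ≡ count p xs
    go []       = refl
    go (x ∷ xs) with p x
    ... | true  = cong suc (go xs)
    ... | false = go xs

  countV-cong : ∀ {n} {p q : Fin n → Bool} → (∀ v → p v ≡ q v) → countV p ≡ countV q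
  countV-cong {zero}      p≗q = refl
  countV-cong {suc n} {p} {q} p≗q = begin
    countV p                                  ≡⟨ countV-suc p ⟩
    indicator (p zero) + countV (p ∘ suc)     ≡⟨ cong₂ _+_ (cong indicator (p≗q zero)) (countV-cong (p≗q ∘ suc)) ⟩
    indicator (q zero) + countV (q ∘ suc)     ≡⟨ countV-suc q ⟨
    countV q                                  ∎
    where open ≡-Reasoning

  countV-mono : ∀ {n} {p q : Fin n → Bool} → (∀ v → p v ≡ true → q v ≡ true) → countV p ≤ countV q
  countV-mono {zero}          p⇒q = z≤n
  countV-mono {suc n} {p} {q} p⇒q = subst₂ _≤_ (sym (countV-suc p)) (sym (countV-suc q))
    (ℕP.+-mono-≤ (indicator-mono (p zero) (q zero) (p⇒q zero)) (countV-mono (p⇒q ∘ suc)))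

  countV-false : ∀ n → countV {n} (λ _ → false) ≡ 0
  countV-false zero    = refl
  countV-false (suc n) = trans (countV-suc {n} (λ _ → false)) (countV-false n)

  countV-insert : ∀ {n} (p q : Fin n → Bool) (v : Fin n) → q v ≡ true → p v ≡ false →
                  (∀ w → w ≢ v → q w ≡ p w) → countV q ≡ suc (countV p)
  countV-insert {suc n} p q zero qv pv q≗p = begin
    countV q                                    ≡⟨ countV-suc q ⟩
    indicator (q zero) + countV (q ∘ suc)
      ≡⟨ cong₂ _+_ (cong indicator qv) (countV-cong (λ w → q≗p (suc w) (λ ()))) ⟩
    suc (countV (p ∘ suc))                      ≡⟨ cong (λ b → suc (indicator b + countV (p ∘ suc))) pv ⟨
    suc (indicator (p zero) + countV (p ∘ suc)) ≡⟨ cong suc (countV-suc p) ⟨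
    suc (countV p)                              ∎
    where open ≡-Reasoning
  countV-insert {suc n} p q (suc v) qv pv q≗p = begin
    countV q                                    ≡⟨ countV-suc q ⟩
    indicator (q zero) + countV (q ∘ suc)
      ≡⟨ cong₂ _+_ (cong indicator (q≗p zero (λ ())))
                   (countV-insert (p ∘ suc) (q ∘ suc) v qv pv (λ w w≢v → q≗p (suc w) (w≢v ∘ FinP.suc-injective))) ⟩
    indicator (p zero) + suc (countV (p ∘ suc)) ≡⟨ ℕP.+-suc (indicator (p zero)) _ ⟩
    suc (indicator (p zero) + countV (p ∘ suc)) ≡⟨ cong suc (countV-suc p) ⟨
    suc (countV p)                              ∎
    where open ≡-Reasoning

  ∣S∣≡countV : ∀ {n} (S : Subset n) → ∣ S ∣ ≡ countV (memb S)
  ∣S∣≡countV []          = refl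
  ∣S∣≡countV (true ∷ S)  = trans (cong suc (∣S∣≡countV S)) (sym (countV-suc (memb (true ∷ S))))
  ∣S∣≡countV (false ∷ S) = trans (∣S∣≡countV S) (sym (countV-suc (memb (false ∷ S))))

  ∣tabulate∣ : ∀ {n} (p : Fin n → Bool) → ∣ Vec.tabulate p ∣ ≡ countV p
  ∣tabulate∣ p = trans (∣S∣≡countV (Vec.tabulate p)) (countV-cong (VecP.lookup∘tabulate p))

  ∈-allSubsets : ∀ {n} (S : Subset n) → S ∈ allSubsets n
  ∈-allSubsets []                  = here refl
  ∈-allSubsets {suc n} (false ∷ S) = ∈-++⁺ˡ (∈-map⁺ (false ∷_) (∈-allSubsets S))
  ∈-allSubsets {suc n} (true ∷ S)  = ∈-++⁺ʳ (map (false ∷_) (allSubsets n)) (∈-map⁺ (true ∷_) (∈-allSubsets S))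

  memb-toggle-self : ∀ {n} (v : Fin n) S → memb (toggle v S) v ≡ not (memb S v)
  memb-toggle-self zero    (b ∷ S) = refl
  memb-toggle-self (suc v) (b ∷ S) = memb-toggle-self v S

  memb-toggle-other : ∀ {n} {u v : Fin n} S → u ≢ v → memb (toggle v S) u ≡ memb S u
  memb-toggle-other {u = zero}  {zero}  S       u≢v = ⊥-elim (u≢v refl)
  memb-toggle-other {u = zero}  {suc v} (b ∷ S) u≢v = refl
  memb-toggle-other {u = suc u} {zero}  (b ∷ S) u≢v = refl
  memb-toggle-other {u = suc u} {suc v} (b ∷ S) u≢v = memb-toggle-other S (u≢v ∘ cong suc)

  ∣toggle∣ : ∀ {n} (v : Fin n) S → memb S v ≡ false → ∣ toggle v S ∣ ≡ suc ∣ S ∣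
  ∣toggle∣ zero    (false ∷ S) e = refl
  ∣toggle∣ (suc v) (true ∷ S)  e = cong suc (∣toggle∣ v S e)
  ∣toggle∣ (suc v) (false ∷ S) e = ∣toggle∣ v S e

  infix 4 _⊆ᵇ_

  _⊆ᵇ_ : ∀ {n} → Subset n → Subset n → Bool
  []      ⊆ᵇ []      = true
  (a ∷ S) ⊆ᵇ (b ∷ A) = (if a then b else true) ∧ (S ⊆ᵇ A)

  ⊆ᵇ⇒⊆ : ∀ {n} (S A : Subset n) → (S ⊆ᵇ A) ≡ true → ∀ x → memb S x ≡ true → memb A x ≡ true
  ⊆ᵇ⇒⊆ (true ∷ S) (b ∷ A) e zero    m = ∧-conicalˡ b _ e
  ⊆ᵇ⇒⊆ (a ∷ S)    (b ∷ A) e (suc x) m = ⊆ᵇ⇒⊆ S A (∧-conicalʳ (if a then b else true) _ e) x m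

  ⊆⇒⊆ᵇ : ∀ {n} (S A : Subset n) → (∀ x → memb S x ≡ true → memb A x ≡ true) → (S ⊆ᵇ A) ≡ true
  ⊆⇒⊆ᵇ []          []      S⊆A = refl
  ⊆⇒⊆ᵇ (true ∷ S)  (b ∷ A) S⊆A = ∧-intro (S⊆A zero refl) (⊆⇒⊆ᵇ S A (S⊆A ∘ suc))
  ⊆⇒⊆ᵇ (false ∷ S) (b ∷ A) S⊆A = ⊆⇒⊆ᵇ S A (S⊆A ∘ suc)

  ⊆ᵇ⇒∣∣≤ : ∀ {n} (S A : Subset n) → (S ⊆ᵇ A) ≡ true → ∣ S ∣ ≤ ∣ A ∣
  ⊆ᵇ⇒∣∣≤ []          []          e = z≤n
  ⊆ᵇ⇒∣∣≤ (true ∷ S)  (true ∷ A)  e = s≤s (⊆ᵇ⇒∣∣≤ S A e)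
  ⊆ᵇ⇒∣∣≤ (false ∷ S) (true ∷ A)  e = ℕP.m≤n⇒m≤1+n (⊆ᵇ⇒∣∣≤ S A e)
  ⊆ᵇ⇒∣∣≤ (false ∷ S) (false ∷ A) e = ⊆ᵇ⇒∣∣≤ S A e

  kSubsetOfᵇ : ∀ {n} → Subset n → ℕ → Subset n → Bool
  kSubsetOfᵇ A k S = (S ⊆ᵇ A) ∧ (∣ S ∣ ≡ᵇ k)

  count-kSubsetOf : ∀ n (A : Subset n) k → count (kSubsetOfᵇ A k) (allSubsets n) ≡ ∣ A ∣ C k
  count-kSubsetOf zero    []          zero    = refl
  count-kSubsetOf zero    []          (suc k) = refl
  count-kSubsetOf (suc n) (false ∷ A) k       = trans (NatSum.∑-allSubsets-suc n _)
    (trans (cong₂ _+_ (count-kSubsetOf n A k) (NatSum.∑-ε (allSubsets n))) (ℕP.+-identityʳ _))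
  count-kSubsetOf (suc n) (true ∷ A)  zero    = trans (NatSum.∑-allSubsets-suc n _)
    (cong₂ _+_ (count-kSubsetOf n A zero) (trans (NatSum.∑-cong (allSubsets n) (λ S → cong indicator (∧-zeroʳ (S ⊆ᵇ A))))
                                                 (NatSum.∑-ε (allSubsets n))))
  count-kSubsetOf (suc n) (true ∷ A)  (suc k) = begin
    count (kSubsetOfᵇ (true ∷ A) (suc k)) (allSubsets (suc n))
      ≡⟨ NatSum.∑-allSubsets-suc n _ ⟩
    count (kSubsetOfᵇ A (suc k)) (allSubsets n) + count (kSubsetOfᵇ A k) (allSubsets n)
      ≡⟨ cong₂ _+_ (count-kSubsetOf n A (suc k)) (count-kSubsetOf n A k) ⟩
    ∣ A ∣ C suc k + ∣ A ∣ C k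
      ≡⟨ ℕP.+-comm (∣ A ∣ C suc k) (∣ A ∣ C k) ⟩
    ∣ A ∣ C k + ∣ A ∣ C suc k
      ≡⟨ nCk+nC[k+1]≡[n+1]C[k+1] ∣ A ∣ k ⟩
    suc ∣ A ∣ C suc k
      ∎
    where open ≡-Reasoning

  intermediate-subset : ∀ {n} (B A : Subset n) k → (B ⊆ᵇ A) ≡ true → ∣ B ∣ ≤ k → k ≤ ∣ A ∣ →
                        ∃ λ S → (B ⊆ᵇ S) ≡ true × (S ⊆ᵇ A) ≡ true × ∣ S ∣ ≡ k
  intermediate-subset [] [] .zero e z≤n z≤n = [] , refl , refl , refl
  intermediate-subset (true ∷ B) (true ∷ A) (suc k) e (s≤s b≤k) (s≤s k≤a)
    with S , B⊆S , S⊆A , ∣S∣≡k ← intermediate-subset B A k e b≤k k≤a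
    = true ∷ S , B⊆S , S⊆A , cong suc ∣S∣≡k
  intermediate-subset (false ∷ B) (false ∷ A) k e b≤k k≤a
    with S , B⊆S , S⊆A , ∣S∣≡k ← intermediate-subset B A k e b≤k k≤a
    = false ∷ S , B⊆S , S⊆A , ∣S∣≡k
  intermediate-subset (false ∷ B) (true ∷ A) k e b≤k k≤1+a with k ℕ.≤? ∣ A ∣
  ... | yes k≤a with S , B⊆S , S⊆A , ∣S∣≡k ← intermediate-subset B A k e b≤k k≤a
    = false ∷ S , B⊆S , S⊆A , ∣S∣≡k
  intermediate-subset (false ∷ B) (true ∷ A) zero e b≤k k≤1+a | no k≰a = ⊥-elim (k≰a z≤n)
  intermediate-subset (false ∷ B) (true ∷ A) (suc k) e b≤k (s≤s k≤a) | no 1+k≰a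
    with S , B⊆S , S⊆A , ∣S∣≡k ←
           intermediate-subset B A k e (ℕP.≤-trans (⊆ᵇ⇒∣∣≤ B A e) (ℕP.≤-pred (ℕP.≰⇒> 1+k≰a))) k≤a
    = true ∷ S , B⊆S , S⊆A , cong suc ∣S∣≡k

  pair : ∀ {n} → Fin n → Fin n → Subset n
  pair u w = Vec.tabulate (λ x → does (x ≟ u) ∨ does (x ≟ w))

  memb-pair : ∀ {n} (u w x : Fin n) → memb (pair u w) x ≡ does (x ≟ u) ∨ does (x ≟ w)
  memb-pair u w = VecP.lookup∘tabulate _

  memb-pair-left : ∀ {n} (u w : Fin n) → memb (pair u w) u ≡ true
  memb-pair-left u w = trans (memb-pair u w u) (cong (_∨ does (u ≟ w)) (dec-true (u ≟ u) refl))

  memb-pair-right : ∀ {n} (u w : Fin n) → memb (pair u w) w ≡ true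
  memb-pair-right u w =
    trans (memb-pair u w w) (trans (cong (does (w ≟ u) ∨_) (dec-true (w ≟ w) refl)) (∨-zeroʳ _))

  memb-pair⁻ : ∀ {n} (u w x : Fin n) → memb (pair u w) x ≡ true → x ≡ u ⊎ x ≡ w
  memb-pair⁻ u w x m with x ≟ u | x ≟ w | memb-pair u w x
  ... | yes x≡u | _       | _ = inj₁ x≡u
  ... | no _    | yes x≡w | _ = inj₂ x≡w
  ... | no _    | no _    | e with () ← trans (sym m) e

  ∣pair∣ : ∀ {n} (u w : Fin n) → u ≢ w → ∣ pair u w ∣ ≡ 2
  ∣pair∣ {n} u w u≢w = begin
    ∣ pair u w ∣                                ≡⟨ ∣tabulate∣ (λ x → does (x ≟ u) ∨ does (x ≟ w)) ⟩
    countV (λ x → does (x ≟ u) ∨ does (x ≟ w))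
      ≡⟨ countV-insert _ _ u (cong (_∨ does (u ≟ w)) (dec-true (u ≟ u) refl)) (dec-false (u ≟ w) u≢w)
                       (λ x x≢u → cong (_∨ does (x ≟ w)) (dec-false (x ≟ u) x≢u)) ⟩
    suc (countV (λ x → does (x ≟ w)))
      ≡⟨ cong suc (countV-insert _ _ w (dec-true (w ≟ w) refl) refl (λ x x≢w → dec-false (x ≟ w) x≢w)) ⟩
    suc (suc (countV {n} (λ _ → false)))        ≡⟨ cong (λ m → 2 + m) (countV-false n) ⟩
    2                                           ∎
    where open ≡-Reasoning

  distinct-members⇒2≤∣S∣ : ∀ {n} (S : Subset n) {u w} → memb S u ≡ true → memb S w ≡ true → u ≢ w → 2 ≤ ∣ S ∣
  distinct-members⇒2≤∣S∣ S {u} {w} u∈S w∈S u≢w =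
    subst (_≤ ∣ S ∣) (∣pair∣ u w u≢w) (⊆ᵇ⇒∣∣≤ (pair u w) S (⊆⇒⊆ᵇ (pair u w) S pair⊆S))
    where
    pair⊆S : ∀ x → memb (pair u w) x ≡ true → memb S x ≡ true
    pair⊆S x x∈pair with memb-pair⁻ u w x x∈pair
    ... | inj₁ refl = u∈S
    ... | inj₂ refl = w∈S

  and-map≡true⇒ : ∀ {A : Set} (f : A → Bool) xs → foldr _∧_ true (map f xs) ≡ true → ∀ x → x ∈ xs → f x ≡ true
  and-map≡true⇒ f (y ∷ xs) e x (here refl) = ∧-conicalˡ (f y) _ e
  and-map≡true⇒ f (y ∷ xs) e x (there x∈)  = and-map≡true⇒ f xs (∧-conicalʳ (f y) _ e) x x∈

  and-map≡true⇐ : ∀ {A : Set} (f : A → Bool) xs → (∀ x → f x ≡ true) → foldr _∧_ true (map f xs) ≡ true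
  and-map≡true⇐ f []       f≡true = refl
  and-map≡true⇐ f (y ∷ xs) f≡true = ∧-intro (f≡true y) (and-map≡true⇐ f xs f≡true)

  module _ {n : ℕ} (G : Graph n) where

    IsClique : Subset n → Set
    IsClique S = ∀ u w → memb S u ≡ true → memb S w ≡ true → u ≢ w → adj G u w ≡ true

    private
      pairAdjᵇ : Subset n → Fin n → Fin n → Bool
      pairAdjᵇ S u w = if memb S u ∧ memb S w ∧ not ⌊ u ≟ w ⌋ then adj G u w else true

    allAdjB⇒IsClique : ∀ S → allAdjB G S ≡ true → IsClique S
    allAdjB⇒IsClique S e u w u∈S w∈S u≢w
      with and-map≡true⇒ (pairAdjᵇ S u) (allFin n) (and-map≡true⇒ _ (allFin n) e u (∈-allFin u)) w (∈-allFin w)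
    ... | h rewrite u∈S | w∈S | trans (isYes≗does (u ≟ w)) (dec-false (u ≟ w) u≢w) = h

    IsClique⇒allAdjB : ∀ S → IsClique S → allAdjB G S ≡ true
    IsClique⇒allAdjB S clique = and-map≡true⇐ _ (allFin n) (λ u → and-map≡true⇐ _ (allFin n) (pairAdj u))
      where
      pairAdj : ∀ u w → pairAdjᵇ S u w ≡ true
      pairAdj u w with memb S u in u∈S | memb S w in w∈S | u ≟ w
      ... | true  | true  | no u≢w = clique u w u∈S w∈S u≢w
      ... | true  | true  | yes _  = refl
      ... | true  | false | _      = refl
      ... | false | _     | _      = refl

    private
      thetaOver : Subset n → List (Fin n) → ℕ
      thetaOver T = foldr (λ v acc → if memb T v then degree G v ⊔ acc else acc) 0

      degree≤thetaOver : ∀ T xs v → v ∈ xs → memb T v ≡ true → degree G v ≤ thetaOver T xs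
      degree≤thetaOver T (y ∷ xs) v (here refl) v∈T rewrite v∈T = ℕP.m≤m⊔n (degree G v) _
      degree≤thetaOver T (y ∷ xs) v (there v∈) v∈T with memb T y
      ... | true  = ℕP.≤-trans (degree≤thetaOver T xs v v∈ v∈T) (ℕP.m≤n⊔m (degree G y) _)
      ... | false = degree≤thetaOver T xs v v∈ v∈T

      thetaOver-lub : ∀ T xs c → (∀ u → memb T u ≡ true → degree G u ≤ c) → thetaOver T xs ≤ c
      thetaOver-lub T []       c bound = z≤n
      thetaOver-lub T (y ∷ xs) c bound with memb T y in y∈T
      ... | true  = ℕP.⊔-lub (bound y y∈T) (thetaOver-lub T xs c bound)
      ... | false = thetaOver-lub T xs c bound

    degree≤theta : ∀ T v → memb T v ≡ true → degree G v ≤ theta G T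
    degree≤theta T v = degree≤thetaOver T (allFin n) v (∈-allFin v)

    theta-const : ∀ T v c → (∀ u → memb T u ≡ true → degree G u ≡ c) → memb T v ≡ true → theta G T ≡ c
    theta-const T v c const v∈T = ℕP.≤-antisym
      (thetaOver-lub T (allFin n) c (λ u u∈T → ℕP.≤-reflexive (const u u∈T)))
      (subst (_≤ theta G T) (const v v∈T) (degree≤theta T v v∈T))

    neighbours : Fin n → Subset n
    neighbours v = Vec.tabulate (adj G v)

    memb-neighbours : ∀ v w → memb (neighbours v) w ≡ adj G v w
    memb-neighbours v = VecP.lookup∘tabulate (adj G v)

    ∣neighbours∣ : ∀ v → ∣ neighbours v ∣ ≡ degree G v
    ∣neighbours∣ v = ∣tabulate∣ (adj G v)

    closedNbrᵇ : Fin n → Fin n → Bool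
    closedNbrᵇ v w = does (w ≟ v) ∨ adj G v w

    countV-closedNbr : ∀ v → countV (closedNbrᵇ v) ≡ suc (degree G v)
    countV-closedNbr v = countV-insert (adj G v) (closedNbrᵇ v) v
      (cong (_∨ adj G v v) (dec-true (v ≟ v) refl)) (loopless G v)
      (λ w w≢v → cong (_∨ adj G v w) (dec-false (w ≟ v) w≢v))

    closedNbr⁺ : ∀ v w → w ≡ v ⊎ adj G v w ≡ true → closedNbrᵇ v w ≡ true
    closedNbr⁺ v w (inj₁ refl) = cong (_∨ adj G v v) (dec-true (v ≟ v) refl)
    closedNbr⁺ v w (inj₂ vw) with does (w ≟ v)
    ... | true  = refl
    ... | false = vw

    closedNbr⁻ : ∀ v w → closedNbrᵇ v w ≡ true → w ≡ v ⊎ adj G v w ≡ true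
    closedNbr⁻ v w e with w ≟ v
    ... | yes w≡v = inj₁ w≡v
    ... | no _    = inj₂ e

    clique-member⁻ : ∀ S v w → IsClique S → memb S v ≡ true → memb S w ≡ true → w ≡ v ⊎ adj G v w ≡ true
    clique-member⁻ S v w clique v∈S w∈S with w ≟ v
    ... | yes w≡v = inj₁ w≡v
    ... | no w≢v  = inj₂ (clique v w v∈S w∈S (w≢v ∘ sym))

    -- A (k+1)-clique lies in the closed neighbourhood of each of its vertices.
    clique-member-degree : ∀ S k v → IsClique S → ∣ S ∣ ≡ suc k → memb S v ≡ true → k ≤ degree G v
    clique-member-degree S k v clique ∣S∣≡1+k v∈S = ℕP.≤-pred
      (subst₂ _≤_ (trans (sym (∣S∣≡countV S)) ∣S∣≡1+k) (countV-closedNbr v)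
        (countV-mono (λ w w∈S → closedNbr⁺ v w (clique-member⁻ S v w clique v∈S w∈S))))

    Connected-trans : ∀ {u v w} → Connected G u v → Connected G v w → Connected G u w
    Connected-trans here          v~w = v~w
    Connected-trans (step uv u~v) v~w = step uv (Connected-trans u~v v~w)

    Connected-sym : ∀ {u v} → Connected G u v → Connected G v u
    Connected-sym here                  = here
    Connected-sym (step {u} {v} uv v~w) =
      Connected-trans (Connected-sym v~w) (step (trans (Graph.sym G v u) uv) here)

  1≤C : ∀ d k → k ≤ d → 1 ≤ d C k
  1≤C d       zero    _         = s≤s z≤n
  1≤C (suc d) (suc k) (s≤s k≤d) = subst (1 ≤_) (nCk+nC[k+1]≡[n+1]C[k+1] d k)
    (ℕP.≤-trans (1≤C d k k≤d) (ℕP.m≤m+n (d C k) _))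

  1≤C⇒≤ : ∀ d k → 1 ≤ d C k → k ≤ d
  1≤C⇒≤ d k 1≤dCk with k ℕ.≤? d
  ... | yes k≤d = k≤d
  ... | no  k≰d with () ← subst (1 ≤_) (k>n⇒nCk≡0 (ℕP.≰⇒> k≰d)) 1≤dCk

  C-≤-suc : ∀ d k → d C k ≤ suc d C k
  C-≤-suc d zero    = ℕP.≤-refl
  C-≤-suc d (suc k) = subst (d C suc k ≤_) (nCk+nC[k+1]≡[n+1]C[k+1] d k) (ℕP.m≤n+m (d C suc k) _)

  C-monoˡ : ∀ k {d e} → d ≤ e → d C k ≤ e C k
  C-monoˡ k {e = zero}  z≤n   = ℕP.≤-refl
  C-monoˡ k {d} {suc e} d≤1+e with d ℕ.≟ suc e
  ... | yes refl  = ℕP.≤-refl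
  ... | no  d≢1+e = ℕP.≤-trans (C-monoˡ k (ℕP.≤-pred (ℕP.≤∧≢⇒< d≤1+e d≢1+e))) (C-≤-suc e k)

  sumℚ-filter : ∀ {A : Set} (xs : List A) (p : A → Bool) (g : A → ℚ) →
                sumℚ (map g (filter (T? ∘ p) xs)) ≡ RatSum.∑ xs (λ x → if p x then g x else 0ℚ)
  sumℚ-filter []       p g = refl
  sumℚ-filter (x ∷ xs) p g with p x
  ... | true  = cong (g x ℚ.+_) (sumℚ-filter xs p g)
  ... | false = trans (sumℚ-filter xs p g) (sym (ℚP.+-identityˡ _))

  squeeze : ∀ {a b c d : ℚ} → a ℚ.≤ b → b ≡ c → c ℚ.≤ d → a ≡ d → a ≡ b × c ≡ d
  squeeze {a} {b} {c} {d} a≤b refl c≤d refl = ℚP.≤-antisym a≤b c≤d , ℚP.≤-antisym c≤d a≤b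

  if-mono-≤ : ∀ (b : Bool) {x y : ℚ} → (b ≡ true → x ℚ.≤ y) → (if b then x else 0ℚ) ℚ.≤ (if b then y else 0ℚ)
  if-mono-≤ true  x≤y = x≤y refl
  if-mono-≤ false x≤y = ℚP.≤-refl

  ∣S∣·c : ∀ {n} (S : Subset n) c → ∣ S ∣ · c ≡ RatSum.∑ (allFin n) (λ v → if memb S v then c else 0ℚ)
  ∣S∣·c {n} S c = trans (cong (_· c) (trans (∣S∣≡countV S) (countV≡count (memb S))))
                         (sym (RatSum.∑-indicator (allFin n) (memb S) c))

  module _ {n : ℕ} (G : Graph n) (k : ℕ) where

    open RatSum using (∑; ∑-cong; ∑-mono-≤; ∑-≤-≡⇒≡)

    subsets : List (Subset n)
    subsets = allSubsets n

    vertices : List (Fin n)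
    vertices = allFin n

    isKₜ : Subset n → Bool
    isKₜ S = allAdjB G S ∧ (∣ S ∣ ≡ᵇ suc k)

    isKₜ⇒IsClique : ∀ S → isKₜ S ≡ true → IsClique G S
    isKₜ⇒IsClique S e = allAdjB⇒IsClique G S (∧-conicalˡ _ _ e)

    isKₜ⇒∣∣ : ∀ S → isKₜ S ≡ true → ∣ S ∣ ≡ suc k
    isKₜ⇒∣∣ S e = ≡ᵇ⇒≡ _ _ (∧-conicalʳ (allAdjB G S) _ e)

    isKₜ-intro : ∀ S → IsClique G S → ∣ S ∣ ≡ suc k → isKₜ S ≡ true
    isKₜ-intro S clique ∣S∣≡t = ∧-intro (IsClique⇒allAdjB G S clique) (≡ᵇ-intro ∣S∣≡t)

    weight : ℕ → ℚ
    weight d = recip (d C k)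

    cliqueTerm : Subset n → ℚ
    cliqueTerm S = if isKₜ S then weight (theta G S) else 0ℚ

    vertexTerm : Subset n → Fin n → ℚ
    vertexTerm S v = if isKₜ S ∧ memb S v then weight (degree G v) else 0ℚ

    cliquesThrough : Fin n → ℕ
    cliquesThrough v = count (λ S → isKₜ S ∧ memb S v) subsets

    scaledSum vertexSum degreeSum : ℚ
    scaledSum = ∑ subsets (λ S → suc k · cliqueTerm S)
    vertexSum = ∑ subsets (λ S → ∑ vertices (vertexTerm S))
    degreeSum = ∑ vertices (λ v → cliquesThrough v · weight (degree G v))

    scaledSum≡ : suc k · cliqueSum G (suc k) ≡ scaledSum
    scaledSum≡ = trans (cong (suc k ·_) (sumℚ-filter subsets isKₜ (weight ∘ theta G)))
                       (RatSum.·-distrib-∑ (suc k) subsets cliqueTerm)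

    vertexSum≡degreeSum : vertexSum ≡ degreeSum
    vertexSum≡degreeSum = trans (RatSum.∑-comm subsets vertices vertexTerm)
      (∑-cong vertices (λ v → RatSum.∑-indicator subsets (λ S → isKₜ S ∧ memb S v) (weight (degree G v))))

    ∑vertices-1 : ∑ vertices (λ _ → 1ℚ) ≡ n · 1ℚ
    ∑vertices-1 = trans (RatSum.∑-const vertices 1ℚ) (cong (_· 1ℚ) (ListP.length-tabulate {n = n} (λ v → v)))

    spreadTerm : Subset n → Fin n → ℚ
    spreadTerm S v = if memb S v then weight (theta G S) else 0ℚ

    scaled-cliqueTerm : ∀ S → isKₜ S ≡ true → suc k · cliqueTerm S ≡ ∑ vertices (spreadTerm S)
    scaled-cliqueTerm S e = begin
      suc k · cliqueTerm S          ≡⟨ cong (λ b → suc k · (if b then weight (theta G S) else 0ℚ)) e ⟩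
      suc k · weight (theta G S)    ≡⟨ cong (_· weight (theta G S)) (isKₜ⇒∣∣ S e) ⟨
      ∣ S ∣ · weight (theta G S)    ≡⟨ ∣S∣·c S (weight (theta G S)) ⟩
      ∑ vertices (spreadTerm S)     ∎
      where open ≡-Reasoning

    vertexTerm-Kₜ : ∀ S → isKₜ S ≡ true → ∀ v → vertexTerm S v ≡ (if memb S v then weight (degree G v) else 0ℚ)
    vertexTerm-Kₜ S e v = cong (λ b → if b ∧ memb S v then weight (degree G v) else 0ℚ) e

    weight-theta≤weight-degree : ∀ S → isKₜ S ≡ true → ∀ v → memb S v ≡ true →
                                 weight (theta G S) ℚ.≤ weight (degree G v)
    weight-theta≤weight-degree S e v v∈S =
      recip-antimono (degree G v C k) (theta G S C k)
        (1≤C (degree G v) k (clique-member-degree G S k v (isKₜ⇒IsClique S e) (isKₜ⇒∣∣ S e) v∈S))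
        (C-monoˡ k (degree≤theta G S v v∈S))

    spreadTerm≤vertexTerm : ∀ S → isKₜ S ≡ true → ∀ v → spreadTerm S v ℚ.≤ vertexTerm S v
    spreadTerm≤vertexTerm S e v = subst (spreadTerm S v ℚ.≤_) (sym (vertexTerm-Kₜ S e v))
      (if-mono-≤ (memb S v) (weight-theta≤weight-degree S e v))

    scaled-cliqueTerm-∉ : ∀ S → isKₜ S ≡ false → suc k · cliqueTerm S ≡ 0ℚ
    scaled-cliqueTerm-∉ S e =
      trans (cong (λ b → suc k · (if b then weight (theta G S) else 0ℚ)) e) (RatSum.·-ε (suc k))

    ∑vertexTerm-∉ : ∀ S → isKₜ S ≡ false → ∑ vertices (vertexTerm S) ≡ 0ℚ
    ∑vertexTerm-∉ S e =
      trans (∑-cong vertices (λ v → cong (λ b → if b ∧ memb S v then weight (degree G v) else 0ℚ) e))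
            (RatSum.∑-ε vertices)

    scaled-cliqueTerm≤ : ∀ S → suc k · cliqueTerm S ℚ.≤ ∑ vertices (vertexTerm S)
    scaled-cliqueTerm≤ S = cases (isKₜ S) refl
      where
      cases : ∀ b → isKₜ S ≡ b → suc k · cliqueTerm S ℚ.≤ ∑ vertices (vertexTerm S)
      cases true  e = subst (ℚ._≤ ∑ vertices (vertexTerm S)) (sym (scaled-cliqueTerm S e))
                        (∑-mono-≤ vertices (λ v _ → spreadTerm≤vertexTerm S e v))
      cases false e = ℚP.≤-reflexive (trans (scaled-cliqueTerm-∉ S e) (sym (∑vertexTerm-∉ S e)))

    -- ExtendsAt v S holds iff v ∉ S and S ∪ {v} is a t-clique; since toggle v is an involution
    -- on subsets, these S are counted by cliquesThrough v.
    ExtendsAt : Fin n → Subset n → Bool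
    ExtendsAt v S = isKₜ (toggle v S) ∧ memb (toggle v S) v

    cliquesThrough-toggle : ∀ v → cliquesThrough v ≡ count (ExtendsAt v) subsets
    cliquesThrough-toggle v = sym (NatSum.∑-allSubsets-toggle n v (λ S → indicator (isKₜ S ∧ memb S v)))

    ExtendsAt⇒kSubset : ∀ v S → ExtendsAt v S ≡ true → kSubsetOfᵇ (neighbours G v) k S ≡ true
    ExtendsAt⇒kSubset v S e = ∧-intro (⊆⇒⊆ᵇ S (neighbours G v) S⊆N) (≡ᵇ-intro ∣S∣≡k)
      where
      T : Subset n
      T = toggle v S
      T∈Kₜ : isKₜ T ≡ true
      T∈Kₜ = ∧-conicalˡ (isKₜ T) _ e
      v∈T : memb T v ≡ true
      v∈T = ∧-conicalʳ (isKₜ T) _ e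
      v∉S : memb S v ≡ false
      v∉S = not-injective (trans (sym (memb-toggle-self v S)) v∈T)
      ∣S∣≡k : ∣ S ∣ ≡ k
      ∣S∣≡k = ℕP.suc-injective (trans (sym (∣toggle∣ v S v∉S)) (isKₜ⇒∣∣ T T∈Kₜ))
      S⊆N : ∀ x → memb S x ≡ true → memb (neighbours G v) x ≡ true
      S⊆N x x∈S with x ≟ v
      ... | yes refl with () ← trans (sym v∉S) x∈S
      ... | no x≢v = trans (memb-neighbours G v x)
                       (isKₜ⇒IsClique T T∈Kₜ v x v∈T (trans (memb-toggle-other S x≢v) x∈S) (x≢v ∘ sym))

    count-kSubsets-nbr : ∀ v → count (kSubsetOfᵇ (neighbours G v) k) subsets ≡ degree G v C k
    count-kSubsets-nbr v = trans (count-kSubsetOf n (neighbours G v) k) (cong (_C k) (∣neighbours∣ G v))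

    cliquesThrough≤C : ∀ v → cliquesThrough v ≤ degree G v C k
    cliquesThrough≤C v = begin
      cliquesThrough v                              ≡⟨ cliquesThrough-toggle v ⟩
      count (ExtendsAt v) subsets
        ≤⟨ NatSum.∑-mono-≤ subsets (λ S _ → indicator-mono _ _ (ExtendsAt⇒kSubset v S)) ⟩
      count (kSubsetOfᵇ (neighbours G v) k) subsets ≡⟨ count-kSubsets-nbr v ⟩
      degree G v C k                                ∎
      where open ℕP.≤-Reasoning

    vertex-contribution≤1 : ∀ v → cliquesThrough v · weight (degree G v) ℚ.≤ 1ℚ
    vertex-contribution≤1 v = ·-recip-≤-1 _ _ (cliquesThrough≤C v)

    scaledSum≤vertexSum : scaledSum ℚ.≤ vertexSum
    scaledSum≤vertexSum = ∑-mono-≤ subsets (λ S _ → scaled-cliqueTerm≤ S)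

    degreeSum≤n : degreeSum ℚ.≤ ∑ vertices (λ _ → 1ℚ)
    degreeSum≤n = ∑-mono-≤ vertices (λ v _ → vertex-contribution≤1 v)

    cliqueSum≤ : cliqueSum G (suc k) ℚ.≤ + n ℚ./ suc k
    cliqueSum≤ = ·-≤-·1⇒≤-/ (suc k) n _ (begin
      suc k · cliqueSum G (suc k) ≡⟨ scaledSum≡ ⟩
      scaledSum                   ≤⟨ scaledSum≤vertexSum ⟩
      vertexSum                   ≡⟨ vertexSum≡degreeSum ⟩
      degreeSum                   ≤⟨ degreeSum≤n ⟩
      ∑ vertices (λ _ → 1ℚ)       ≡⟨ ∑vertices-1 ⟩
      n · 1ℚ                      ∎)
      where open ℚP.≤-Reasoning

    Saturated : Fin n → Set
    Saturated v = cliquesThrough v ≡ degree G v C k × 1 ≤ degree G v C k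

    Balanced : Set
    Balanced = ∀ S v → isKₜ S ≡ true → memb S v ≡ true → weight (theta G S) ≡ weight (degree G v)

    private
      if-true-injective : ∀ {b : Bool} {x y : ℚ} → b ≡ true →
                          (if b then x else 0ℚ) ≡ (if b then y else 0ℚ) → x ≡ y
      if-true-injective refl x≡y = x≡y

      if-cong : ∀ (b : Bool) {x y : ℚ} → (b ≡ true → x ≡ y) → (if b then x else 0ℚ) ≡ (if b then y else 0ℚ)
      if-cong true  x≡y = x≡y refl
      if-cong false x≡y = refl

    scaledSum≡vertexSum⇒Balanced : scaledSum ≡ vertexSum → Balanced
    scaledSum≡vertexSum⇒Balanced eq S v S∈Kₜ v∈S =
      if-true-injective v∈S (trans spread≡vertex (vertexTerm-Kₜ S S∈Kₜ v))
      where
      term≡ : suc k · cliqueTerm S ≡ ∑ vertices (vertexTerm S)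
      term≡ = ∑-≤-≡⇒≡ subsets (λ S _ → scaled-cliqueTerm≤ S) eq S (∈-allSubsets S)
      spread≡vertex : spreadTerm S v ≡ vertexTerm S v
      spread≡vertex = ∑-≤-≡⇒≡ vertices (λ v _ → spreadTerm≤vertexTerm S S∈Kₜ v)
                        (trans (sym (scaled-cliqueTerm S S∈Kₜ)) term≡) v (∈-allFin v)

    degreeSum≡n⇒Saturated : degreeSum ≡ ∑ vertices (λ _ → 1ℚ) → ∀ v → Saturated v
    degreeSum≡n⇒Saturated eq v =
      ·-recip≡1⇒≡ _ _ (∑-≤-≡⇒≡ vertices (λ v _ → vertex-contribution≤1 v) eq v (∈-allFin v))

    Balanced⇒scaled-cliqueTerm≡ : Balanced → ∀ S → suc k · cliqueTerm S ≡ ∑ vertices (vertexTerm S)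
    Balanced⇒scaled-cliqueTerm≡ balanced S = cases (isKₜ S) refl
      where
      cases : ∀ b → isKₜ S ≡ b → suc k · cliqueTerm S ≡ ∑ vertices (vertexTerm S)
      cases true  e = trans (scaled-cliqueTerm S e) (∑-cong vertices (λ v →
        trans (if-cong (memb S v) (balanced S v e)) (sym (vertexTerm-Kₜ S e v))))
      cases false e = trans (scaled-cliqueTerm-∉ S e) (sym (∑vertexTerm-∉ S e))

    Saturated⇒contribution≡1 : ∀ v → Saturated v → cliquesThrough v · weight (degree G v) ≡ 1ℚ
    Saturated⇒contribution≡1 v (through≡C , 1≤C) rewrite through≡C =
      ·-recip-self (degree G v C k) {{ℕ.>-nonZero 1≤C}}

    cliqueSum≡⇔ : (cliqueSum G (suc k) ≡ + n ℚ./ suc k) ⇔ ((∀ v → Saturated v) × Balanced)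
    cliqueSum≡⇔ = mk⇔ to from
      where
      to : cliqueSum G (suc k) ≡ + n ℚ./ suc k → (∀ v → Saturated v) × Balanced
      to eq with scaled≡vertex , degree≡n ← squeeze scaledSum≤vertexSum vertexSum≡degreeSum degreeSum≤n
                   (trans (sym scaledSum≡) (trans (Equivalence.from (·≡·1⇔≡/ (suc k) n _) eq) (sym ∑vertices-1)))
        = degreeSum≡n⇒Saturated degree≡n , scaledSum≡vertexSum⇒Balanced scaled≡vertex
      from : (∀ v → Saturated v) × Balanced → cliqueSum G (suc k) ≡ + n ℚ./ suc k
      from (saturated , balanced) = Equivalence.to (·≡·1⇔≡/ (suc k) n _) (begin
        suc k · cliqueSum G (suc k) ≡⟨ scaledSum≡ ⟩
        scaledSum                   ≡⟨ ∑-cong subsets (Balanced⇒scaled-cliqueTerm≡ balanced) ⟩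
        vertexSum                   ≡⟨ vertexSum≡degreeSum ⟩
        degreeSum                   ≡⟨ ∑-cong vertices (λ v → Saturated⇒contribution≡1 v (saturated v)) ⟩
        ∑ vertices (λ _ → 1ℚ)       ≡⟨ ∑vertices-1 ⟩
        n · 1ℚ                      ∎)
        where open ≡-Reasoning

  module _ {n : ℕ} (G : Graph n) where

    ∣S∣≡1⇒IsClique : ∀ S → ∣ S ∣ ≡ 1 → IsClique G S
    ∣S∣≡1⇒IsClique S ∣S∣≡1 u w u∈S w∈S u≢w
      with s≤s () ← subst (2 ≤_) ∣S∣≡1 (distinct-members⇒2≤∣S∣ S u∈S w∈S u≢w)

    adj⇒≢ : ∀ {u w} → adj G u w ≡ true → u ≢ w
    adj⇒≢ {u} uw refl with () ← trans (sym (loopless G u)) uw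

    neighbour⇒≢ : ∀ {v x} → memb (neighbours G v) x ≡ true → x ≢ v
    neighbour⇒≢ {v} {x} x∈N x≡v = adj⇒≢ (trans (sym (memb-neighbours G v x)) x∈N) (sym x≡v)

    pair-IsClique : ∀ {u w} → adj G u w ≡ true → IsClique G (pair u w)
    pair-IsClique {u} {w} uw x y x∈ y∈ x≢y with memb-pair⁻ u w x x∈ | memb-pair⁻ u w y y∈
    ... | inj₁ refl | inj₁ refl = ⊥-elim (x≢y refl)
    ... | inj₁ refl | inj₂ refl = uw
    ... | inj₂ refl | inj₁ refl = trans (Graph.sym G w u) uw
    ... | inj₂ refl | inj₂ refl = ⊥-elim (x≢y refl)

    EdgesPreserveDegree : Set
    EdgesPreserveDegree = ∀ u w → adj G u w ≡ true → degree G u ≡ degree G w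

    module _ (k : ℕ) where

      EdgesPreserveDegree⇒Balanced : EdgesPreserveDegree → Balanced G k
      EdgesPreserveDegree⇒Balanced preserve S v S∈Kₜ v∈S =
        cong (weight G k) (theta-const G S v (degree G v) same-degree v∈S)
        where
        same-degree : ∀ u → memb S u ≡ true → degree G u ≡ degree G v
        same-degree u u∈S with clique-member⁻ G S v u (isKₜ⇒IsClique G k S S∈Kₜ) v∈S u∈S
        ... | inj₁ refl = refl
        ... | inj₂ vu   = sym (preserve v u vu)

      kClique-in-nbr⇒ExtendsAt : ∀ v S → kSubsetOfᵇ (neighbours G v) k S ≡ true → IsClique G S →
                                 ExtendsAt G k v S ≡ true
      kClique-in-nbr⇒ExtendsAt v S S∈kN clique = ∧-intro (isKₜ-intro G k T T-clique ∣T∣≡t) v∈T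
        where
        S⊆N : ∀ x → memb S x ≡ true → memb (neighbours G v) x ≡ true
        S⊆N = ⊆ᵇ⇒⊆ S (neighbours G v) (∧-conicalˡ _ _ S∈kN)
        T : Subset n
        T = toggle v S
        v∉S : memb S v ≡ false
        v∉S with memb S v in v∈S
        ... | false = refl
        ... | true  = ⊥-elim (neighbour⇒≢ (S⊆N v v∈S) refl)
        v∈T : memb T v ≡ true
        v∈T = trans (memb-toggle-self v S) (cong not v∉S)
        ∣T∣≡t : ∣ T ∣ ≡ suc k
        ∣T∣≡t = trans (∣toggle∣ v S v∉S) (cong suc (≡ᵇ⇒≡ _ _ (∧-conicalʳ _ _ S∈kN)))
        x∈S : ∀ x → x ≢ v → memb T x ≡ true → memb S x ≡ true
        x∈S x x≢v x∈T = trans (sym (memb-toggle-other S x≢v)) x∈T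
        v-adj : ∀ x → x ≢ v → memb T x ≡ true → adj G v x ≡ true
        v-adj x x≢v x∈T = trans (sym (memb-neighbours G v x)) (S⊆N x (x∈S x x≢v x∈T))
        T-clique : IsClique G T
        T-clique x y x∈T y∈T x≢y with x ≟ v | y ≟ v
        ... | yes refl | yes refl = ⊥-elim (x≢y refl)
        ... | yes refl | no y≢v   = v-adj y y≢v y∈T
        ... | no x≢v   | yes refl = trans (Graph.sym G x v) (v-adj x x≢v x∈T)
        ... | no x≢v   | no y≢v   = clique x y (x∈S x x≢v x∈T) (x∈S y y≢v y∈T) x≢y

      Saturated-intro : ∀ v → k ≤ degree G v → (∀ S → kSubsetOfᵇ (neighbours G v) k S ≡ true → IsClique G S) →
                        Saturated G k v
      Saturated-intro v k≤d kSubsets-cliques =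
        trans (cliquesThrough-toggle G k v) (trans (NatSum.∑-cong (subsets G k) same) (count-kSubsets-nbr G k v)) ,
        1≤C (degree G v) k k≤d
        where
        same : ∀ S → indicator (ExtendsAt G k v S) ≡ indicator (kSubsetOfᵇ (neighbours G v) k S)
        same S with kSubsetOfᵇ (neighbours G v) k S in e | ExtendsAt G k v S in e′
        ... | true  | true  = refl
        ... | false | false = refl
        ... | true  | false with () ← trans (sym (kClique-in-nbr⇒ExtendsAt v S e (kSubsets-cliques S e))) e′
        ... | false | true  with () ← trans (sym (ExtendsAt⇒kSubset G k v S e′)) e

      Saturated⇒ExtendsAt : ∀ v → Saturated G k v → ∀ S → kSubsetOfᵇ (neighbours G v) k S ≡ true →
                            ExtendsAt G k v S ≡ true
      Saturated⇒ExtendsAt v (through≡C , _) S S∈kN = trans (indicator-injective _ _ indicators≡) S∈kN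
        where
        indicators≡ : indicator (ExtendsAt G k v S) ≡ indicator (kSubsetOfᵇ (neighbours G v) k S)
        indicators≡ = NatSum.∑-≤-≡⇒≡ (subsets G k) (λ S _ → indicator-mono _ _ (ExtendsAt⇒kSubset G k v S))
          (trans (sym (cliquesThrough-toggle G k v)) (trans through≡C (sym (count-kSubsets-nbr G k v))))
          S (∈-allSubsets S)

    ComponentsRegular⇒EdgesPreserveDegree : ComponentsRegular G → EdgesPreserveDegree
    ComponentsRegular⇒EdgesPreserveDegree regular u w uw = regular u w (step uw here)

    EdgesPreserveDegree⇒ComponentsRegular : EdgesPreserveDegree → ComponentsRegular G
    EdgesPreserveDegree⇒ComponentsRegular preserve u .u here          = refl
    EdgesPreserveDegree⇒ComponentsRegular preserve u w  (step uv v~w) =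
      trans (preserve _ _ uv) (EdgesPreserveDegree⇒ComponentsRegular preserve _ w v~w)

    NoIsolated⇒0<degree : NoIsolated G → ∀ v → 0 < degree G v
    NoIsolated⇒0<degree noIsolated v with degree G v in d≡
    ... | zero  = ⊥-elim (noIsolated v d≡)
    ... | suc _ = s≤s z≤n

    Saturated-balanced⇔regular :
      ((∀ v → Saturated G 1 v) × Balanced G 1) ⇔ (NoIsolated G × ComponentsRegular G)
    Saturated-balanced⇔regular = mk⇔ to from
      where
      0<degree : (∀ v → Saturated G 1 v) → ∀ v → 0 < degree G v
      0<degree saturated v = subst (1 ≤_) (nC1≡n (degree G v)) (proj₂ (saturated v))
      -- For t = 2 the cliques are the edges, and weight is the reciprocal degree.
      to : (∀ v → Saturated G 1 v) × Balanced G 1 → NoIsolated G × ComponentsRegular G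
      to (saturated , balanced) =
        (λ v d≡0 → ℕP.<-irrefl (sym d≡0) (0<degree saturated v)) ,
        EdgesPreserveDegree⇒ComponentsRegular preserve
        where
        preserve : EdgesPreserveDegree
        preserve u w uw = recip-injective (degree G u) (degree G w)
            {{ℕ.>-nonZero (0<degree saturated u)}} {{ℕ.>-nonZero (0<degree saturated w)}}
            (subst₂ (λ a b → recip a ≡ recip b) (nC1≡n (degree G u)) (nC1≡n (degree G w))
              (trans (sym (balanced e u e∈K (memb-pair-left u w))) (balanced e w e∈K (memb-pair-right u w))))
          where
          e : Subset n
          e = pair u w
          e∈K : isKₜ G 1 e ≡ true
          e∈K = isKₜ-intro G 1 e (pair-IsClique uw) (∣pair∣ u w (adj⇒≢ uw))
      from : NoIsolated G × ComponentsRegular G → (∀ v → Saturated G 1 v) × Balanced G 1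
      from (noIsolated , regular) =
        (λ v → Saturated-intro 1 v (NoIsolated⇒0<degree noIsolated v)
                 (λ S S∈kN → ∣S∣≡1⇒IsClique S (≡ᵇ⇒≡ _ _ (∧-conicalʳ _ _ S∈kN)))) ,
        EdgesPreserveDegree⇒Balanced 1 (ComponentsRegular⇒EdgesPreserveDegree regular)

    NeighbourhoodsAreCliques : Set
    NeighbourhoodsAreCliques = ∀ v u w → adj G v u ≡ true → adj G v w ≡ true → u ≢ w → adj G u w ≡ true

    ComponentsComplete : Set
    ComponentsComplete = ∀ u w → Connected G u w → u ≢ w → adj G u w ≡ true

    NeighbourhoodsAreCliques⇒equal-or-adjacent : NeighbourhoodsAreCliques →
                                                 ∀ {u w} → Connected G u w → u ≡ w ⊎ adj G u w ≡ true
    NeighbourhoodsAreCliques⇒equal-or-adjacent nbrCliques here = inj₁ refl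
    NeighbourhoodsAreCliques⇒equal-or-adjacent nbrCliques {u} {w} (step {v = v} uv v~w)
      with NeighbourhoodsAreCliques⇒equal-or-adjacent nbrCliques v~w | u ≟ w
    ... | inj₁ refl | _       = inj₂ uv
    ... | inj₂ vw   | yes u≡w = inj₁ u≡w
    ... | inj₂ vw   | no u≢w  = inj₂ (nbrCliques v u w (trans (Graph.sym G v u) uv) vw u≢w)

    NeighbourhoodsAreCliques⇒ComponentsComplete : NeighbourhoodsAreCliques → ComponentsComplete
    NeighbourhoodsAreCliques⇒ComponentsComplete nbrCliques u w u~w u≢w
      with NeighbourhoodsAreCliques⇒equal-or-adjacent nbrCliques u~w
    ... | inj₁ u≡w = ⊥-elim (u≢w u≡w)
    ... | inj₂ uw  = uw

    ComponentsComplete⇒NeighbourhoodsAreCliques : ComponentsComplete → NeighbourhoodsAreCliques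
    ComponentsComplete⇒NeighbourhoodsAreCliques complete v u w vu vw =
      complete u w (step (trans (Graph.sym G u v) vu) (step vw here))

    ComponentsComplete⇒closedNbr : ComponentsComplete → ∀ {v w} → Connected G v w → closedNbrᵇ G v w ≡ true
    ComponentsComplete⇒closedNbr complete {v} {w} v~w with w ≟ v
    ... | yes _   = refl
    ... | no w≢v  = complete v w v~w (w≢v ∘ sym)

    closedNbr⇒Connected : ∀ {v w} → closedNbrᵇ G v w ≡ true → Connected G v w
    closedNbr⇒Connected {v} {w} e with closedNbr⁻ G v w e
    ... | inj₁ refl = here
    ... | inj₂ vw   = step vw here

    -- Adjacent vertices of a complete component have the same closed neighbourhood.
    ComponentsComplete⇒EdgesPreserveDegree : ComponentsComplete → EdgesPreserveDegree
    ComponentsComplete⇒EdgesPreserveDegree complete u w uw = ℕP.suc-injective (begin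
      suc (degree G u)         ≡⟨ countV-closedNbr G u ⟨
      countV (closedNbrᵇ G u)  ≡⟨ countV-cong same ⟩
      countV (closedNbrᵇ G w)  ≡⟨ countV-closedNbr G w ⟩
      suc (degree G w)         ∎)
      where
      open ≡-Reasoning
      u~w : Connected G u w
      u~w = step uw here
      same : ∀ x → closedNbrᵇ G u x ≡ closedNbrᵇ G w x
      same x with closedNbrᵇ G u x in eu | closedNbrᵇ G w x in ew
      ... | true  | true  = refl
      ... | false | false = refl
      ... | true  | false with () ← trans (sym (ComponentsComplete⇒closedNbr complete
                                        (Connected-trans G (Connected-sym G u~w) (closedNbr⇒Connected eu)))) ew
      ... | false | true  with () ← trans (sym (ComponentsComplete⇒closedNbr complete
                                        (Connected-trans G u~w (closedNbr⇒Connected ew)))) eu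

    closedNbr-component : ∀ v → ∃ λ (Q : Subset n) →
      v Subset.∈ Q × (∀ w → w Subset.∈ Q → Connected G v w) × ∣ Q ∣ ≡ suc (degree G v)
    closedNbr-component v =
      Q , VecP.lookup⇒[]= v Q (trans (VecP.lookup∘tabulate _ v) (closedNbr⁺ G v v (inj₁ refl))) ,
      (λ w w∈Q → closedNbr⇒Connected (trans (sym (VecP.lookup∘tabulate _ w)) (VecP.[]=⇒lookup w∈Q))) ,
      trans (∣tabulate∣ (closedNbrᵇ G v)) (countV-closedNbr G v)
      where
      Q : Subset n
      Q = Vec.tabulate (closedNbrᵇ G v)

    ComponentsComplete⇒DisjointUnionOfCliques : ∀ k → ComponentsComplete → (∀ v → k ≤ degree G v) →
                                                DisjointUnionOfCliques G (suc k)
    ComponentsComplete⇒DisjointUnionOfCliques k complete k≤d = complete , component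
      where
      component : ∀ v → ∃ λ (Q : Subset n) →
        v Subset.∈ Q × (∀ w → w Subset.∈ Q → Connected G v w) × suc k ≤ ∣ Q ∣
      component v with Q , v∈Q , Q-connected , ∣Q∣≡ ← closedNbr-component v
        = Q , v∈Q , Q-connected , subst (suc k ≤_) (sym ∣Q∣≡) (s≤s (k≤d v))

    DisjointUnionOfCliques⇒k≤degree : ∀ k → DisjointUnionOfCliques G (suc k) → ∀ v → k ≤ degree G v
    DisjointUnionOfCliques⇒k≤degree k (complete , component) v
      with Q , _ , Q-connected , t≤∣Q∣ ← component v
      = ℕP.≤-pred (ℕP.≤-trans t≤∣Q∣ (subst₂ _≤_ (sym (∣S∣≡countV Q)) (countV-closedNbr G v) (countV-mono Q⊆N)))
      where
      Q⊆N : ∀ w → memb Q w ≡ true → closedNbrᵇ G v w ≡ true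
      Q⊆N w w∈Q = ComponentsComplete⇒closedNbr complete (Q-connected w (VecP.lookup⇒[]= w Q w∈Q))

    NeighbourhoodsAreCliques⇒subsets-cliques : NeighbourhoodsAreCliques →
                                               ∀ v S → (S ⊆ᵇ neighbours G v) ≡ true → IsClique G S
    NeighbourhoodsAreCliques⇒subsets-cliques nbrCliques v S S⊆N x y x∈S y∈S =
      nbrCliques v x y (in-nbr x x∈S) (in-nbr y y∈S)
      where
      in-nbr : ∀ x → memb S x ≡ true → adj G v x ≡ true
      in-nbr x x∈S = trans (sym (memb-neighbours G v x)) (⊆ᵇ⇒⊆ S (neighbours G v) S⊆N x x∈S)

    pair⊆neighbours : ∀ {v u w} → adj G v u ≡ true → adj G v w ≡ true →
                      ∀ x → memb (pair u w) x ≡ true → memb (neighbours G v) x ≡ true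
    pair⊆neighbours {v} {u} {w} vu vw x x∈pair with memb-pair⁻ u w x x∈pair
    ... | inj₁ refl = trans (memb-neighbours G v u) vu
    ... | inj₂ refl = trans (memb-neighbours G v w) vw

    -- With k ≥ 2 any two neighbours u, w of v lie in a common k-subset of the neighbourhood.
    Saturated⇒NeighbourhoodsAreCliques : ∀ k → 2 ≤ k → (∀ v → Saturated G k v) → NeighbourhoodsAreCliques
    Saturated⇒NeighbourhoodsAreCliques k 2≤k saturated v u w vu vw u≢w
      with S , pair⊆S , S⊆N , ∣S∣≡k ← intermediate-subset (pair u w) (neighbours G v) k
             (⊆⇒⊆ᵇ (pair u w) (neighbours G v) (pair⊆neighbours vu vw)) (subst (_≤ k) (sym (∣pair∣ u w u≢w)) 2≤k)
             (subst (k ≤_) (sym (∣neighbours∣ G v)) (1≤C⇒≤ (degree G v) k (proj₂ (saturated v))))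
      = isKₜ⇒IsClique G k T (∧-conicalˡ _ _ extends) u w
          (in-T u (memb-pair-left u w)) (in-T w (memb-pair-right u w)) u≢w
      where
      T : Subset n
      T = toggle v S
      extends : ExtendsAt G k v S ≡ true
      extends = Saturated⇒ExtendsAt k v (saturated v) S (∧-intro S⊆N (≡ᵇ-intro ∣S∣≡k))
      in-T : ∀ x → memb (pair u w) x ≡ true → memb T x ≡ true
      in-T x x∈pair = trans (memb-toggle-other S (neighbour⇒≢ (pair⊆neighbours vu vw x x∈pair)))
                            (⊆ᵇ⇒⊆ (pair u w) S pair⊆S x x∈pair)

    Saturated-balanced⇔disjointCliques : ∀ k → 2 ≤ k →
      ((∀ v → Saturated G k v) × Balanced G k) ⇔ DisjointUnionOfCliques G (suc k)
    Saturated-balanced⇔disjointCliques k 2≤k = mk⇔ to from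
      where
      to : (∀ v → Saturated G k v) × Balanced G k → DisjointUnionOfCliques G (suc k)
      to (saturated , _) = ComponentsComplete⇒DisjointUnionOfCliques k
        (NeighbourhoodsAreCliques⇒ComponentsComplete (Saturated⇒NeighbourhoodsAreCliques k 2≤k saturated))
        (λ v → 1≤C⇒≤ (degree G v) k (proj₂ (saturated v)))
      from : DisjointUnionOfCliques G (suc k) → (∀ v → Saturated G k v) × Balanced G k
      from cliques@(complete , _) =
        (λ v → Saturated-intro k v (DisjointUnionOfCliques⇒k≤degree k cliques v)
                 (λ S S∈kN → NeighbourhoodsAreCliques⇒subsets-cliques nbrCliques v S (∧-conicalˡ _ _ S∈kN))) ,
        EdgesPreserveDegree⇒Balanced k (ComponentsComplete⇒EdgesPreserveDegree complete)
        where
        nbrCliques : NeighbourhoodsAreCliques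
        nbrCliques = ComponentsComplete⇒NeighbourhoodsAreCliques complete

open import Data.Integer using (+_)
open import Data.Nat using (ℕ; NonZero; _≥_; suc; s≤s)
open import Data.Product using (_×_; _,_)
open import Data.Rational using (_≤_; _/_)
open import Function.Bundles using (_⇔_)
open import Function.Properties.Equivalence using () renaming (trans to ⇔-trans)
open import Relation.Binary.PropositionalEquality using (_≡_; refl)
open import Defs
open CliqueSumBound using (cliqueSum≤; cliqueSum≡⇔; Saturated-balanced⇔regular; Saturated-balanced⇔disjointCliques)

corollary5p2 : ∀ (n : ℕ) (G : Graph n) (t : ℕ) .{{_ : NonZero t}} →
    (cliqueSum G t ≤ + n / t)
    × (t ≡ 2 → (cliqueSum G t ≡ + n / t) ⇔ (NoIsolated G × ComponentsRegular G))
    × (t ≥ 3 → (cliqueSum G t ≡ + n / t) ⇔ DisjointUnionOfCliques G t)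
corollary5p2 n G (suc k) = cliqueSum≤ G k , t≡2 , t≥3
  where
  t≡2 : suc k ≡ 2 → (cliqueSum G (suc k) ≡ + n / suc k) ⇔ (NoIsolated G × ComponentsRegular G)
  t≡2 refl = ⇔-trans (cliqueSum≡⇔ G 1) (Saturated-balanced⇔regular G)
  t≥3 : suc k ≥ 3 → (cliqueSum G (suc k) ≡ + n / suc k) ⇔ DisjointUnionOfCliques G (suc k)
  t≥3 (s≤s 2≤k) = ⇔-trans (cliqueSum≡⇔ G k) (Saturated-balanced⇔disjointCliques G k 2≤k)
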